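{- Let $G$ be a connected $(v,k,\lambda,\mu)$-strongly regular graph and let $C$ be a clique in $G$ with $q\geq 3$ vertices. If $k-2\lambda-1>0$, then $|N(C)|>2k-\lambda-2$.
   Context: A $(v,k,\lambda,\mu)$-strongly regular graph is a $k$-regular graph on $v$ vertices in which any two adjacent vertices have exactly $\lambda$ common neighbors and any two distinct non-adjacent vertices have exactly $\mu$ common neighbors. For a set $X$ of vertices, $N(X)=\{y\notin X: y \text{ is adjacent to some } x\in X\}$. -}

module Defs where

open import Data.Nat using (ℕ; zero; suc; _+_; _*_; _<_)
open import Data.Bool using (Bool; true; false; _∧_; not)
open import Data.Fin using (Fin)
open import Data.List using (List; length; filterᵇ)
open import Data.Bool.ListAction using (any)
open import Data.List using () renaming (allFin to allFinL)
open import Data.Product using (_×_)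
open import Relation.Binary.PropositionalEquality using (_≡_; _≢_)

record Graph (v : ℕ) : Set where
  field
    adj     : Fin v → Fin v → Bool
    sym     : ∀ x y → adj x y ≡ adj y x
    irrefl  : ∀ x → adj x x ≡ false
open Graph public

count : {v : ℕ} → (Fin v → Bool) → ℕ
count {v} P = length (filterᵇ P (allFinL v))

degree : {v : ℕ} → Graph v → Fin v → ℕ
degree G x = count (adj G x)

commonNbrs : {v : ℕ} → Graph v → Fin v → Fin v → ℕ
commonNbrs G x y = count (λ z → adj G x z ∧ adj G y z)

record IsSRG {v : ℕ} (G : Graph v) (k lam mu : ℕ) : Set where
  field
    regular  : ∀ x → degree G x ≡ k
    adjCase  : ∀ x y → adj G x y ≡ true → commonNbrs G x y ≡ lam
    nonadj   : ∀ x y → x ≢ y → adj G x y ≡ false → commonNbrs G x y ≡ mu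

data Walk {v : ℕ} (G : Graph v) : Fin v → Fin v → Set where
  here : ∀ {x} → Walk G x x
  step : ∀ {x y z} → adj G x y ≡ true → Walk G y z → Walk G x z

Connected : {v : ℕ} → Graph v → Set
Connected G = ∀ x y → Walk G x y

VSet : ℕ → Set
VSet v = Fin v → Bool

card : {v : ℕ} → VSet v → ℕ
card C = count C

IsClique : {v : ℕ} → Graph v → VSet v → Set
IsClique G C = ∀ x y → C x ≡ true → C y ≡ true → x ≢ y → adj G x y ≡ true

nbhd : {v : ℕ} → Graph v → VSet v → VSet v
nbhd {v} G X y = not (X y) ∧ any (λ x → X x ∧ adj G x y) (allFinL v)

-- Take three distinct vertices x, y, z of the clique and count, for each vertex w, how
-- many of x, y, z it is adjacent to. Summed over w this is 3k. Pointwise, by inclusion–exclusion,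
-- that number is at most the number of pairs among x, y, z that w is a common neighbour of, plus
-- one if w is adjacent to any of them; the extra one is only paid by w ∈ {x, y, z} or w ∈ N(C),
-- since every other clique vertex is adjacent to all three and then the pair count is already 3.
-- Summing gives 3k ≤ 3λ + 3 + |N(C)|, and k ≥ 2λ + 2 turns this into 2k ≤ |N(C)| + λ + 1.
module Submission where

open import Defs hiding (sym)
open import Data.Nat using (ℕ; zero; suc; _+_; _*_; _<_; _≤_; z≤n; s≤s)
open import Data.Nat.Properties
  using (≤-refl; ≤-trans; m≤m+n; m≤n+m; +-monoʳ-≤; +-mono-≤; +-cancelʳ-≤; +-suc;
         +-0-commutativeMonoid; module ≤-Reasoning)
open import Data.Nat.Tactic.RingSolver using (solve-∀)
open import Data.Bool using (Bool; true; false; _∧_; _∨_; T; T?)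
open import Data.Bool.Properties using (T-≡)
open import Data.Bool.ListAction using (any)
open import Data.Fin as Fin using (Fin)
open import Data.Fin.Properties using (_≟_)
open import Data.List using (_∷_; length; filterᵇ; tabulate; allFin)
open import Data.List.Membership.Propositional using (lose)
open import Data.List.Membership.Propositional.Properties using (∈-allFin)
open import Data.List.Relation.Unary.All using (All; _∷_)
open import Data.List.Relation.Unary.All.Properties using (all-filter)
open import Data.List.Relation.Unary.AllPairs using (_∷_)
open import Data.List.Relation.Unary.Any.Properties using (any⁺)
open import Data.List.Relation.Unary.Unique.Propositional using (Unique)
import Data.List.Relation.Unary.Unique.Propositional.Properties as Unique
open import Algebra.Properties.CommutativeMonoid.Sum +-0-commutativeMonoid
  using (sum; ∑-distrib-+; sum-cong-≗; sum-replicate-zero)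
open import Function using (_∘_; id; Equivalence)
open import Relation.Nullary using (does; yes; no)
open import Relation.Binary.PropositionalEquality
  using (_≡_; _≢_; refl; sym; trans; cong; cong₂; subst; subst₂; module ≡-Reasoning)

𝟙 : Bool → ℕ
𝟙 true  = 1
𝟙 false = 0

𝟙-mono : ∀ {a b} → (a ≡ true → b ≡ true) → 𝟙 a ≤ 𝟙 b
𝟙-mono {false} a⇒b = z≤n
𝟙-mono {true}  a⇒b rewrite a⇒b refl = ≤-refl

𝟙≤1 : ∀ a → 𝟙 a ≤ 1
𝟙≤1 true  = ≤-refl
𝟙≤1 false = z≤n

inclusion-exclusion₃ : ∀ a b c →
  𝟙 a + 𝟙 b + 𝟙 c ≤ (𝟙 (a ∧ b) + 𝟙 (a ∧ c) + 𝟙 (b ∧ c)) + 𝟙 (a ∨ b ∨ c)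
inclusion-exclusion₃ true  true  true  = m≤m+n 3 1
inclusion-exclusion₃ true  true  false = ≤-refl
inclusion-exclusion₃ true  false true  = ≤-refl
inclusion-exclusion₃ true  false false = ≤-refl
inclusion-exclusion₃ false true  true  = ≤-refl
inclusion-exclusion₃ false true  false = ≤-refl
inclusion-exclusion₃ false false true  = ≤-refl
inclusion-exclusion₃ false false false = ≤-refl

sum-mono-≤ : ∀ {n} {f g : Fin n → ℕ} → (∀ i → f i ≤ g i) → sum f ≤ sum g
sum-mono-≤ {zero}  f≤g = z≤n
sum-mono-≤ {suc n} f≤g = +-mono-≤ (f≤g Fin.zero) (sum-mono-≤ (f≤g ∘ Fin.suc))

∑-distrib-+₃ : ∀ {n} (f g h : Fin n → ℕ) →
  sum (λ i → f i + g i + h i) ≡ sum f + sum g + sum h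
∑-distrib-+₃ f g h =
  trans (∑-distrib-+ (λ i → f i + g i) h) (cong (_+ sum h) (∑-distrib-+ f g))

δ : ∀ {n} → Fin n → Fin n → ℕ
δ x w = 𝟙 (does (x ≟ w))

sum-δ : ∀ {n} (x : Fin n) → sum (δ x) ≡ 1
sum-δ {suc n} Fin.zero    = cong suc (sum-replicate-zero n)
sum-δ {suc n} (Fin.suc x) = trans (sum-cong-≗ δ-suc) (sum-δ x)
  where
  δ-suc : ∀ i → δ (Fin.suc x) (Fin.suc i) ≡ δ x i
  δ-suc i with x ≟ i
  ... | yes _ = refl
  ... | no  _ = refl

length-filterᵇ-tabulate : ∀ {A : Set} {n} (p : A → Bool) (f : Fin n → A) →
  length (filterᵇ p (tabulate f)) ≡ sum (𝟙 ∘ p ∘ f)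
length-filterᵇ-tabulate {n = zero}  p f = refl
length-filterᵇ-tabulate {n = suc n} p f with p (f Fin.zero)
... | true  = cong suc (length-filterᵇ-tabulate p (f ∘ Fin.suc))
... | false = length-filterᵇ-tabulate p (f ∘ Fin.suc)

count≡sum : ∀ {v} (P : Fin v → Bool) → count P ≡ sum (𝟙 ∘ P)
count≡sum P = length-filterᵇ-tabulate P id

any-allFin : ∀ {v} (p : Fin v → Bool) {x} → p x ≡ true → any p (allFin v) ≡ true
any-allFin p px = Equivalence.to T-≡ (any⁺ p (lose (∈-allFin _) (Equivalence.from T-≡ px)))

record DistinctTriple {v : ℕ} (C : VSet v) : Set where
  field
    x y z    : Fin v
    x∈C      : C x ≡ true
    y∈C      : C y ≡ true
    z∈C      : C z ≡ true
    x≢y      : x ≢ y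
    x≢z      : x ≢ z
    y≢z      : y ≢ z

three-distinct : ∀ {v} (C : VSet v) → 3 ≤ card C → DistinctTriple C
three-distinct {v} C 3≤∣C∣ =
  triple (filterᵇ C (allFin v)) 3≤∣C∣ (all-filter (T? ∘ C) (allFin v))
    (Unique.filter⁺ _ (Unique.allFin⁺ v))
  where
  triple : ∀ xs → 3 ≤ length xs → All (T ∘ C) xs → Unique xs → DistinctTriple C
  triple (x ∷ y ∷ z ∷ _) (s≤s (s≤s (s≤s _))) (Cx ∷ Cy ∷ Cz ∷ _)
         ((x≢y ∷ x≢z ∷ _) ∷ (y≢z ∷ _) ∷ _) = record
    { x = x ; y = y ; z = z
    ; x∈C = Equivalence.to T-≡ Cx ; y∈C = Equivalence.to T-≡ Cy ; z∈C = Equivalence.to T-≡ Cz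
    ; x≢y = x≢y ; x≢z = x≢z ; y≢z = y≢z }

module CliqueTriple {v : ℕ} (G : Graph v) {C : VSet v} (clique : IsClique G C)
                    (t : DistinctTriple C) where

  open DistinctTriple t

  adjacencies pairs covered : Fin v → ℕ
  adjacencies w = 𝟙 (adj G x w) + 𝟙 (adj G y w) + 𝟙 (adj G z w)
  pairs w = 𝟙 (adj G x w ∧ adj G y w) + 𝟙 (adj G x w ∧ adj G z w) + 𝟙 (adj G y w ∧ adj G z w)
  covered w = δ x w + δ y w + δ z w + 𝟙 (nbhd G C w)

  adjacent-to-some : Fin v → Bool
  adjacent-to-some w = adj G x w ∨ adj G y w ∨ adj G z w

  adjacencies≤pairs+ : ∀ {m} w → 𝟙 (adjacent-to-some w) ≤ m → adjacencies w ≤ pairs w + m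
  adjacencies≤pairs+ w bound =
    ≤-trans (inclusion-exclusion₃ (adj G x w) (adj G y w) (adj G z w)) (+-monoʳ-≤ (pairs w) bound)

  adjacent-to-clique : Fin v → Bool
  adjacent-to-clique w = any (λ u → C u ∧ adj G u w) (allFin v)

  adjacent-to-some⇒clique : ∀ w → adjacent-to-some w ≡ true → adjacent-to-clique w ≡ true
  adjacent-to-some⇒clique w adjacent
    with adj G x w in x~w | adj G y w in y~w | adj G z w in z~w
  ... | true  | _     | _     = any-allFin (λ u → C u ∧ adj G u w) (cong₂ _∧_ x∈C x~w)
  ... | false | true  | _     = any-allFin (λ u → C u ∧ adj G u w) (cong₂ _∧_ y∈C y~w)
  ... | false | false | true  = any-allFin (λ u → C u ∧ adj G u w) (cong₂ _∧_ z∈C z~w)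

  adjacencies≤pairs+covered : ∀ w → adjacencies w ≤ pairs w + covered w
  adjacencies≤pairs+covered w with C w in w∈C
  -- for w ∉ C, membership in N(C) is adjacent-to-clique w
  ... | false = adjacencies≤pairs+ w
                  (≤-trans (𝟙-mono (adjacent-to-some⇒clique w)) (m≤n+m _ _))
  ... | true with x ≟ w | y ≟ w | z ≟ w
  ...   | yes _ | _     | _     = adjacencies≤pairs+ w (≤-trans (𝟙≤1 _) (s≤s z≤n))
  ...   | no _  | yes _ | _     = adjacencies≤pairs+ w (≤-trans (𝟙≤1 _) (s≤s z≤n))
  ...   | no _  | no _  | yes _ = adjacencies≤pairs+ w (≤-trans (𝟙≤1 _) (s≤s z≤n))
  ...   | no x≢w | no y≢w | no z≢w
    rewrite clique x w x∈C w∈C x≢w | clique y w y∈C w∈C y≢w | clique z w z∈C w∈C z≢w =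
      m≤m+n 3 _

  sum-adjacencies : sum adjacencies ≡ degree G x + degree G y + degree G z
  sum-adjacencies = begin
    sum adjacencies
      ≡⟨ ∑-distrib-+₃ (𝟙 ∘ adj G x) (𝟙 ∘ adj G y) (𝟙 ∘ adj G z) ⟩
    sum (𝟙 ∘ adj G x) + sum (𝟙 ∘ adj G y) + sum (𝟙 ∘ adj G z)
      ≡⟨ sym (cong₂ _+_ (cong₂ _+_ (count≡sum (adj G x)) (count≡sum (adj G y)))
                        (count≡sum (adj G z))) ⟩
    degree G x + degree G y + degree G z ∎
    where open ≡-Reasoning

  sum-pairs : sum pairs ≡ commonNbrs G x y + commonNbrs G x z + commonNbrs G y z
  sum-pairs = trans (∑-distrib-+₃ (𝟙 ∘ common x y) (𝟙 ∘ common x z) (𝟙 ∘ common y z))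
    (sym (cong₂ _+_ (cong₂ _+_ (count≡sum (common x y)) (count≡sum (common x z)))
                    (count≡sum (common y z))))
    where
    common : Fin v → Fin v → Fin v → Bool
    common u u′ w = adj G u w ∧ adj G u′ w

  sum-covered : sum covered ≡ 3 + card (nbhd G C)
  sum-covered = begin
    sum covered
      ≡⟨ ∑-distrib-+ (λ w → δ x w + δ y w + δ z w) (𝟙 ∘ nbhd G C) ⟩
    sum (λ w → δ x w + δ y w + δ z w) + sum (𝟙 ∘ nbhd G C)
      ≡⟨ cong₂ _+_ (trans (∑-distrib-+₃ (δ x) (δ y) (δ z))
                          (cong₂ _+_ (cong₂ _+_ (sum-δ x) (sum-δ y)) (sum-δ z)))
                   (sym (count≡sum (nbhd G C))) ⟩
    3 + card (nbhd G C) ∎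
    where open ≡-Reasoning

  degrees≤commonNbrs+|N| :
    degree G x + degree G y + degree G z ≤
    (commonNbrs G x y + commonNbrs G x z + commonNbrs G y z) + (3 + card (nbhd G C))
  degrees≤commonNbrs+|N| = begin
    degree G x + degree G y + degree G z  ≡⟨ sym sum-adjacencies ⟩
    sum adjacencies                       ≤⟨ sum-mono-≤ adjacencies≤pairs+covered ⟩
    sum (λ w → pairs w + covered w)       ≡⟨ ∑-distrib-+ pairs covered ⟩
    sum pairs + sum covered               ≡⟨ cong₂ _+_ sum-pairs sum-covered ⟩
    (commonNbrs G x y + commonNbrs G x z + commonNbrs G y z) + (3 + card (nbhd G C)) ∎
    where open ≤-Reasoning

double-counting-arithmetic : ∀ k lam n →
  k + k + k ≤ (lam + lam + lam) + (3 + n) → 2 * lam + 1 < k → 2 * k < n + lam + 2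
double-counting-arithmetic k lam n 3k≤ 2lam+1<k =
  subst (2 * k <_) (sym (+-suc (n + lam) 1)) (s≤s 2k≤n+lam+1)
  where
  open ≤-Reasoning
  split-3k : ∀ k → k + k + k ≡ 2 * k + k
  split-3k = solve-∀
  split-rhs : ∀ lam n → (lam + lam + lam) + (3 + n) ≡ (n + lam + 1) + (2 * lam + 2)
  split-rhs = solve-∀
  2lam+2≤k : 2 * lam + 2 ≤ k
  2lam+2≤k = subst (_≤ k) (sym (+-suc (2 * lam) 1)) 2lam+1<k
  2k≤n+lam+1 : 2 * k ≤ n + lam + 1
  2k≤n+lam+1 = +-cancelʳ-≤ (2 * lam + 2) (2 * k) (n + lam + 1) (begin
    2 * k + (2 * lam + 2)          ≤⟨ +-monoʳ-≤ (2 * k) 2lam+2≤k ⟩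
    2 * k + k                      ≡⟨ sym (split-3k k) ⟩
    k + k + k                      ≤⟨ 3k≤ ⟩
    (lam + lam + lam) + (3 + n)    ≡⟨ split-rhs lam n ⟩
    (n + lam + 1) + (2 * lam + 2)  ∎)

srg-clique-bound : ∀ {v k lam mu} {G : Graph v} {C : VSet v} → IsSRG G k lam mu → IsClique G C →
  3 ≤ card C → k + k + k ≤ (lam + lam + lam) + (3 + card (nbhd G C))
srg-clique-bound {k = k} {lam} {G = G} {C} srg clique 3≤∣C∣ = subst₂ _≤_
  (cong₂ _+_ (cong₂ _+_ (regular x) (regular y)) (regular z))
  (cong (_+ (3 + card (nbhd G C)))
        (cong₂ _+_ (cong₂ _+_ (λ-for x∈C y∈C x≢y) (λ-for x∈C z∈C x≢z)) (λ-for y∈C z∈C y≢z)))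
  (CliqueTriple.degrees≤commonNbrs+|N| G clique triple)
  where
  open IsSRG srg
  triple : DistinctTriple C
  triple = three-distinct C 3≤∣C∣
  open DistinctTriple triple
  λ-for : ∀ {u w} → C u ≡ true → C w ≡ true → u ≢ w → commonNbrs G u w ≡ lam
  λ-for u∈C w∈C u≢w = adjCase _ _ (clique _ _ u∈C w∈C u≢w)

mainTheorem8 : ∀ {v k lam mu : ℕ} (G : Graph v) → IsSRG G k lam mu → Connected G →
    (C : VSet v) → IsClique G C → 3 ≤ card C →
    2 * lam + 1 < k →
    2 * k < card (nbhd G C) + lam + 2
mainTheorem8 {k = k} {lam} G srg _ C clique 3≤∣C∣ 2lam+1<k =
  double-counting-arithmetic k lam (card (nbhd G C)) (srg-clique-bound srg clique 3≤∣C∣) 2lam+1<k
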